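{- Let $P\in\mathcal{C}(G_n)$. If $A, B \in \mathrm{char}(P)$, then $A\subseteq B$ or $B\subseteq A$.
   Context: Let $Q_n=\{1,\dots,n\}$ be a set of $n$ yes/no questions. An outcome on a set $S\subseteq Q_n$ is an element of $\{0,1\}^{|S|}$, and $X_S$ denotes the set of all outcomes on $S$. A preference matrix on $Q_n$ is a $2^n\times n$ matrix with entries in $\{0,1\}$ whose rows are the $2^n$ outcomes on $Q_n$, each appearing exactly once, ordered from most preferred (top) to least preferred (bottom). For a nonempty proper subset $S\subset Q_n$ and an outcome $x$ on $Q_n-S$, $P^{[Q_n-S,x]}$ denotes the submatrix of $P$ formed by the columns indexed by $S$ and the rows of $P$ whose outcome on $Q_n-S$ is $x$ (in the order they appear in $P$). $S$ is separable with respect to $P$ if $P^{[Q_n-S,x]}=P^{[Q_n-S,y]}$ for all $x,y\in X_{Q_n-S}$; $\emptyset$ and $Q_n$ are always considered separable. The character $\mathrm{char}(P)$ is the set of all subsets of $Q_n$ that are separable with respect to $P$. $G_n$ denotes the $n$-dimensional hypercube graph whose $2^n$ vertices are labeled by the outcomes in $\{0,1\}^n$ so that adjacent vertices differ in exactly one bit (Gray code labeling); $\mathcal{C}(G_n)$ is the set of preference matrices whose rows, top to bottom, list the vertex labels in the order traversed by some Hamiltonian path of $G_n$ (equivalently, preference matrices in which consecutive rows differ in exactly one entry). Elements of $\mathcal{C}(G_n)$ are called cubic preferences. -}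

module Defs where

open import Data.Nat using (ℕ; zero; suc; _^_)
open import Data.Bool using (Bool; true; false; _xor_)
import Data.Bool.Properties as BoolP
open import Data.List using (List; []; _∷_; filter; map; length)
import Data.List.Properties as ListP
open import Data.Vec using (Vec; []; _∷_; lookup; toList; zipWith)
open import Data.Fin using (Fin)
open import Data.Fin.Subset using (Subset; ∁; ⊥; ⊤)
open import Data.Product using (_×_)
open import Data.Sum using (_⊎_)
open import Data.Unit using () renaming (⊤ to Unit)
open import Relation.Binary.PropositionalEquality using (_≡_)

-- An outcome on Q_n is a row vector in {0,1}^n (Bool: false = 0, true = 1).
Outcome : ℕ → Set
Outcome n = Vec Bool n

-- Preference matrix: 2^n rows (index 0 = top = most preferred), each
-- outcome on Q_n appearing exactly once.
record PrefMatrix (n : ℕ) : Set where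
  field
    rows      : Vec (Outcome n) (2 ^ n)
    injective : ∀ (i j : Fin (2 ^ n)) → lookup rows i ≡ lookup rows j → i ≡ j
    surjective : ∀ (x : Outcome n) → Data.Product.∃ (λ i → lookup rows i ≡ x)
open PrefMatrix public

restrict : ∀ {n} → Subset n → Outcome n → List Bool
restrict []          []      = []
restrict (true ∷ t)  (b ∷ r) = b ∷ restrict t r
restrict (false ∷ t) (b ∷ r) = restrict t r

-- P^{[Q_n - S, x]} : rows of P (in order) whose outcome on Q_n - S is x,
-- restricted to the columns of S.
subMatrix : ∀ {n} → PrefMatrix n → Subset n → List Bool → List (List Bool)
subMatrix P S x =
  map (restrict S)
      (filter (λ r → ListP.≡-dec BoolP._≟_ (restrict (∁ S) r) x) (toList (rows P)))

IsOutcomeOn : ∀ {n} → Subset n → List Bool → Set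
IsOutcomeOn T x = length x ≡ Data.Fin.Subset.∣ T ∣

Separable : ∀ {n} → PrefMatrix n → Subset n → Set
Separable P S =
  (S ≡ ⊥) ⊎ (S ≡ ⊤) ⊎
  (∀ x y → IsOutcomeOn (∁ S) x → IsOutcomeOn (∁ S) y →
     subMatrix P S x ≡ subMatrix P S y)

_∈char_ : ∀ {n} → Subset n → PrefMatrix n → Set
S ∈char P = Separable P S

hamming : ∀ {n} → Outcome n → Outcome n → ℕ
hamming x y = length (filter (λ b → b BoolP.≟ true) (toList (zipWith _xor_ x y)))

ConsecAdj : ∀ {n} → List (Outcome n) → Set
ConsecAdj []            = Unit
ConsecAdj (x ∷ [])      = Unit
ConsecAdj (x ∷ y ∷ rs)  = (hamming x y ≡ 1) × ConsecAdj (y ∷ rs)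

-- P ∈ C(G_n): cubic preference
Cubic : ∀ {n} → PrefMatrix n → Set
Cubic P = ConsecAdj (toList (rows P))

-- Let S be a nontrivial separable set of questions and call a row top-aligned if it agrees on
-- S with the top row r₀. If v is top-aligned and the row u just above it is not, then u and v
-- differ in a question of S, so they agree off S and lie in the same fibre. That fibre's
-- S-submatrix equals the one of r₀'s fibre and so starts with r₀'s S-part; since u is not
-- top-aligned, an earlier row w of the fibre must carry it, and then w agrees with v both on S
-- and off S, i.e. w = v, contradicting that rows are distinct. Hence top-aligned rows form an
-- initial segment of a cubic preference. Now take a ∈ A ∖ B and b ∈ B ∖ A and flip bit a,
-- resp. b, of r₀. Whichever of the two rows comes first contradicts this initial-segment
-- property for B, resp. A.
module Submission where

open import Defs
open import Data.Nat using (ℕ; suc; pred)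
open import Data.Bool using (Bool; true; false; not)
import Data.Bool.Properties as BoolP
open import Data.List using (List; []; _∷_; _++_; filter; map; tabulate)
import Data.List.Properties as ListP
open import Data.List.Membership.Propositional using (_∈_)
open import Data.List.Membership.Propositional.Properties using (∈-filter⁻)
open import Data.List.Relation.Unary.Any using (here; there)
open import Data.List.Relation.Unary.All using (All)
import Data.List.Relation.Unary.All as All
import Data.List.Relation.Unary.All.Properties as Allₚ
open import Data.List.Relation.Unary.AllPairs using (AllPairs; []; _∷_)
import Data.List.Relation.Unary.AllPairs as AllPairs
open import Data.List.Relation.Unary.Linked using (Linked; []; [-]; _∷_)
open import Data.List.Relation.Unary.Linked.Properties using (Linked⇒AllPairs)
open import Data.List.Relation.Unary.Unique.Propositional using (Unique)
import Data.List.Relation.Unary.Unique.Propositional.Properties as Unique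
open import Data.Vec using (Vec; []; _∷_; lookup; toList; replicate; _[_]%=_)
open import Data.Vec.Membership.Propositional.Properties using (∈-toList⁺; ∈-lookup)
open import Data.Vec.Base using (here; there)
open import Data.Fin using (Fin; zero; suc)
open import Data.Fin.Subset using (Subset; _⊆_; ∁) renaming (_∈_ to _∈ₛ_; _∉_ to _∉ₛ_)
import Data.Fin.Subset.Properties as Subset
open import Data.Product using (_×_; _,_; ∃; ∃₂)
open import Data.Sum using (_⊎_; inj₁; inj₂)
import Data.Sum as Sum
open import Data.Empty using (⊥; ⊥-elim)
open import Function using (id; _∘_)
open import Relation.Nullary using (¬_; Dec)
open import Relation.Binary.PropositionalEquality

AgreeOn : ∀ {n} → Subset n → Outcome n → Outcome n → Set
AgreeOn S u v = restrict S u ≡ restrict S v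

restrict-length : ∀ {n} (T : Subset n) (v : Outcome n) → IsOutcomeOn T (restrict T v)
restrict-length []          []      = refl
restrict-length (true ∷ T)  (b ∷ v) = cong suc (restrict-length T v)
restrict-length (false ∷ T) (b ∷ v) = restrict-length T v

restrict-injective : ∀ {n} (S : Subset n) {u v : Outcome n} →
  AgreeOn S u v → AgreeOn (∁ S) u v → u ≡ v
restrict-injective []          {[]}    {[]}    _ _ = refl
restrict-injective (true ∷ S)  {_ ∷ _} {_ ∷ _} p q =
  cong₂ _∷_ (ListP.∷-injectiveˡ p) (restrict-injective S (ListP.∷-injectiveʳ p) q)
restrict-injective (false ∷ S) {_ ∷ _} {_ ∷ _} p q =
  cong₂ _∷_ (ListP.∷-injectiveˡ q) (restrict-injective S p (ListP.∷-injectiveʳ q))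

hamming≡0⇒≡ : ∀ {n} (u v : Outcome n) → hamming u v ≡ 0 → u ≡ v
hamming≡0⇒≡ []          []          _ = refl
hamming≡0⇒≡ (false ∷ u) (false ∷ v) h = cong (false ∷_) (hamming≡0⇒≡ u v h)
hamming≡0⇒≡ (true ∷ u)  (true ∷ v)  h = cong (true ∷_) (hamming≡0⇒≡ u v h)

AgreeOnOneSide : ∀ {n} → Subset n → Outcome n → Outcome n → Set
AgreeOnOneSide S u v = AgreeOn S u v ⊎ AgreeOn (∁ S) u v

agreeOnOneSide-∷ : ∀ {n} t (S : Subset n) b {u v : Outcome n} →
  AgreeOnOneSide S u v → AgreeOnOneSide (t ∷ S) (b ∷ u) (b ∷ v)
agreeOnOneSide-∷ true  S b = Sum.map (cong (b ∷_)) id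
agreeOnOneSide-∷ false S b = Sum.map id (cong (b ∷_))

agreeOnOneSide-head : ∀ {n} t (S : Subset n) b c (v : Outcome n) →
  AgreeOnOneSide (t ∷ S) (b ∷ v) (c ∷ v)
agreeOnOneSide-head true  S b c v = inj₂ refl
agreeOnOneSide-head false S b c v = inj₁ refl

hamming≡1⇒agreeOnOneSide : ∀ {n} (S : Subset n) {u v : Outcome n} → hamming u v ≡ 1 →
  AgreeOnOneSide S u v
hamming≡1⇒agreeOnOneSide [] {[]} {[]} ()
hamming≡1⇒agreeOnOneSide (t ∷ S) {false ∷ u} {false ∷ v} h =
  agreeOnOneSide-∷ t S false (hamming≡1⇒agreeOnOneSide S h)
hamming≡1⇒agreeOnOneSide (t ∷ S) {true ∷ u} {true ∷ v} h =
  agreeOnOneSide-∷ t S true (hamming≡1⇒agreeOnOneSide S h)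
hamming≡1⇒agreeOnOneSide (t ∷ S) {false ∷ u} {true ∷ v} h
  rewrite hamming≡0⇒≡ u v (cong pred h) = agreeOnOneSide-head t S false true v
hamming≡1⇒agreeOnOneSide (t ∷ S) {true ∷ u} {false ∷ v} h
  rewrite hamming≡0⇒≡ u v (cong pred h) = agreeOnOneSide-head t S true false v

restrict-flip-∉ : ∀ {n} {i : Fin n} {S : Subset n} (v : Outcome n) (f : Bool → Bool) →
  i ∉ₛ S → AgreeOn S (v [ i ]%= f) v
restrict-flip-∉ {i = zero}  {true ∷ S}  (b ∷ v) f i∉S = ⊥-elim (i∉S here)
restrict-flip-∉ {i = zero}  {false ∷ S} (b ∷ v) f i∉S = refl
restrict-flip-∉ {i = suc i} {true ∷ S}  (b ∷ v) f i∉S = cong (b ∷_) (restrict-flip-∉ v f (i∉S ∘ there))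
restrict-flip-∉ {i = suc i} {false ∷ S} (b ∷ v) f i∉S = restrict-flip-∉ v f (i∉S ∘ there)

restrict-flip-∈ : ∀ {n} {i : Fin n} {S : Subset n} (v : Outcome n) →
  i ∈ₛ S → ¬ AgreeOn S (v [ i ]%= not) v
restrict-flip-∈ (false ∷ v) here ()
restrict-flip-∈ (true ∷ v)  here ()
restrict-flip-∈ {S = true ∷ S}  (b ∷ v) (there i∈S) = restrict-flip-∈ v i∈S ∘ ListP.∷-injectiveʳ
restrict-flip-∈ {S = false ∷ S} (b ∷ v) (there i∈S) = restrict-flip-∈ v i∈S

⊆-or-∃∉ : ∀ {n} (A B : Subset n) → A ⊆ B ⊎ ∃ λ a → a ∈ₛ A × a ∉ₛ B
⊆-or-∃∉ []      []      = inj₁ λ ()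
⊆-or-∃∉ (x ∷ A) (y ∷ B) with ⊆-or-∃∉ A B
... | inj₂ (a , a∈A , a∉B) = inj₂ (suc a , there a∈A , λ { (there a∈B) → a∉B a∈B })
⊆-or-∃∉ (false ∷ A) (y ∷ B)     | inj₁ A⊆B = inj₁ λ { (there a∈A) → there (A⊆B a∈A) }
⊆-or-∃∉ (true ∷ A)  (true ∷ B)  | inj₁ A⊆B = inj₁ λ { here → here ; (there a∈A) → there (A⊆B a∈A) }
⊆-or-∃∉ (true ∷ A)  (false ∷ B) | inj₁ _   = inj₂ (zero , here , λ ())

module _ {a r} {A : Set a} {R : A → A → Set r} where

  AllPairs-++-∈ : ∀ {xs ys x} → AllPairs R (xs ++ ys) → x ∈ xs → All (R x) ys
  AllPairs-++-∈ {_ ∷ xs} (px ∷ _)   (here refl) = Allₚ.++⁻ʳ xs px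
  AllPairs-++-∈          (_ ∷ pxs)  (there x∈)  = AllPairs-++-∈ pxs x∈

  AllPairs-total : ∀ {xs x y} → AllPairs R xs → x ∈ xs → y ∈ xs → x ≢ y → R x y ⊎ R y x
  AllPairs-total _          (here refl) (here refl) x≢y = ⊥-elim (x≢y refl)
  AllPairs-total (px ∷ _)   (here refl) (there y∈)  _   = inj₁ (All.lookup px y∈)
  AllPairs-total (py ∷ _)   (there x∈)  (here refl) _   = inj₂ (All.lookup py x∈)
  AllPairs-total (_ ∷ pxs)  (there x∈)  (there y∈)  x≢y = AllPairs-total pxs x∈ y∈ x≢y

  Linked-from-splits : ∀ xs → (∀ pre {u v post} → xs ≡ pre ++ u ∷ v ∷ post → R u v) → Linked R xs
  Linked-from-splits []           _ = []
  Linked-from-splits (x ∷ [])     _ = [-]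
  Linked-from-splits (x ∷ y ∷ xs) R-at =
    R-at [] refl ∷ Linked-from-splits (y ∷ xs) (λ pre eq → R-at (x ∷ pre) (cong (x ∷_) eq))

head-of-map-++ : ∀ {a b} {A : Set a} {B : Set b} (g : A → B) ws {u zs s t} →
  map g (ws ++ u ∷ zs) ≡ s ∷ t → g u ≡ s ⊎ ∃ λ w → w ∈ ws × g w ≡ s
head-of-map-++ g []       eq = inj₁ (ListP.∷-injectiveˡ eq)
head-of-map-++ g (w ∷ ws) eq = inj₂ (w , here refl , ListP.∷-injectiveˡ eq)

ConsecAdj-split : ∀ {n} (pre : List (Outcome n)) {u v post} →
  ConsecAdj (pre ++ u ∷ v ∷ post) → hamming u v ≡ 1
ConsecAdj-split []            (adj , _) = adj
ConsecAdj-split (_ ∷ [])      {u} {v} {post} (_ , c) = ConsecAdj-split [] {u} {v} {post} c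
ConsecAdj-split (_ ∷ p ∷ pre) {u} {v} {post} (_ , c) = ConsecAdj-split (p ∷ pre) {u} {v} {post} c

toList≡tabulate∘lookup : ∀ {a} {A : Set a} {m} (v : Vec A m) → toList v ≡ tabulate (lookup v)
toList≡tabulate∘lookup []      = refl
toList≡tabulate∘lookup (x ∷ v) = cong (x ∷_) (toList≡tabulate∘lookup v)

module _ {n} (P : PrefMatrix n) where

  rows-unique : Unique (toList (rows P))
  rows-unique = subst Unique (sym (toList≡tabulate∘lookup (rows P)))
                      (Unique.tabulate⁺ (injective P _ _))

  ∈-rows : ∀ x → x ∈ toList (rows P)
  ∈-rows x with surjective P x
  ... | i , refl = ∈-toList⁺ (∈-lookup i (rows P))

  rows-nonempty : ∃₂ λ r₀ rest → toList (rows P) ≡ r₀ ∷ rest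
  rows-nonempty with toList (rows P) | ∈-rows (replicate n false)
  ... | r₀ ∷ rest | _ = r₀ , rest , refl

FibresAgree : ∀ {n} → PrefMatrix n → Subset n → Set
FibresAgree P S =
  ∀ x y → IsOutcomeOn (∁ S) x → IsOutcomeOn (∁ S) y → subMatrix P S x ≡ subMatrix P S y

separable⇒fibresAgree : ∀ {n} (P : PrefMatrix n) {S : Subset n} {a b : Fin n} →
  a ∈ₛ S → b ∉ₛ S → S ∈char P → FibresAgree P S
separable⇒fibresAgree _ a∈S _   (inj₁ refl)         = ⊥-elim (Subset.∉⊥ a∈S)
separable⇒fibresAgree _ _   b∉S (inj₂ (inj₁ refl))  = ⊥-elim (b∉S Subset.∈⊤)
separable⇒fibresAgree _ _   _   (inj₂ (inj₂ agree)) = agree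

module InitialSegment {n} (P : PrefMatrix n) (S : Subset n) (agree : FibresAgree P S)
  {r₀ : Outcome n} {rest : List (Outcome n)} (rows≡ : toList (rows P) ≡ r₀ ∷ rest) where

  TopAligned : Outcome n → Set
  TopAligned r = AgreeOn S r r₀

  _inherits_ : Outcome n → Outcome n → Set
  u inherits v = TopAligned v → TopAligned u

  -- Literally the filter predicate of subMatrix, so that subMatrix unfolds to a filter over it.
  in-fibre? : ∀ x (r : Outcome n) → Dec (restrict (∁ S) r ≡ x)
  in-fibre? x r = ListP.≡-dec BoolP._≟_ (restrict (∁ S) r) x

  subMatrix-starts-with-top : ∀ x → IsOutcomeOn (∁ S) x →
    ∃ λ t → subMatrix P S x ≡ restrict S r₀ ∷ t
  subMatrix-starts-with-top x ∣x∣ = _ , (begin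
    subMatrix P S x
      ≡⟨ agree x (restrict (∁ S) r₀) ∣x∣ (restrict-length (∁ S) r₀) ⟩
    map (restrict S) (filter (in-fibre? (restrict (∁ S) r₀)) (toList (rows P)))
      ≡⟨ cong (map (restrict S) ∘ filter (in-fibre? (restrict (∁ S) r₀))) rows≡ ⟩
    map (restrict S) (filter (in-fibre? (restrict (∁ S) r₀)) (r₀ ∷ rest))
      ≡⟨ cong (map (restrict S)) (ListP.filter-accept (in-fibre? (restrict (∁ S) r₀)) refl) ⟩
    restrict S r₀ ∷ _ ∎)
    where open ≡-Reasoning

  fibre-split : ∀ pre {u v post} → toList (rows P) ≡ pre ++ u ∷ v ∷ post → AgreeOn (∁ S) u v →
    let fibre = filter (in-fibre? (restrict (∁ S) v))
    in fibre (toList (rows P)) ≡ fibre pre ++ u ∷ fibre (v ∷ post)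
  fibre-split pre {u} {v} {post} rows-split u≈v-off = begin
    fibre (toList (rows P))              ≡⟨ cong fibre rows-split ⟩
    fibre (pre ++ u ∷ v ∷ post)          ≡⟨ ListP.filter-++ (in-fibre? x) pre _ ⟩
    fibre pre ++ fibre (u ∷ v ∷ post)    ≡⟨ cong (fibre pre ++_) (ListP.filter-accept (in-fibre? x) u≈v-off) ⟩
    fibre pre ++ u ∷ fibre (v ∷ post)    ∎
    where
    open ≡-Reasoning
    x : List Bool
    x = restrict (∁ S) v
    fibre : List (Outcome n) → List (Outcome n)
    fibre = filter (in-fibre? x)

  adjacent-inherits : Unique (toList (rows P)) → ∀ pre {u v post} →
    toList (rows P) ≡ pre ++ u ∷ v ∷ post → hamming u v ≡ 1 → u inherits v
  adjacent-inherits uniq pre {u} {v} {post} rows-split adj v-top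
    with hamming≡1⇒agreeOnOneSide S adj
  ... | inj₁ u≈v = trans u≈v v-top
  ... | inj₂ u≈v-off
    with subMatrix-starts-with-top (restrict (∁ S) v) (restrict-length (∁ S) v)
  ... | t , starts-with-top
    with head-of-map-++ (restrict S) (filter (in-fibre? (restrict (∁ S) v)) pre)
           (trans (sym (cong (map (restrict S)) (fibre-split pre rows-split u≈v-off))) starts-with-top)
  ... | inj₁ u-top = u-top
  ... | inj₂ (w , w∈ , w-top) with ∈-filter⁻ (in-fibre? (restrict (∁ S) v)) {xs = pre} w∈
  ... | w∈pre , w≈v-off = ⊥-elim (w≢v (restrict-injective S (trans w-top (sym v-top)) w≈v-off))
    where
    w≢v : w ≢ v
    w≢v = All.lookup (AllPairs-++-∈ (subst Unique rows-split uniq) w∈pre) (there (here refl))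

  rows-inherit : Cubic P → AllPairs _inherits_ (toList (rows P))
  rows-inherit cubic = Linked⇒AllPairs (λ u⇐v v⇐w → u⇐v ∘ v⇐w)
    (Linked-from-splits (toList (rows P)) λ pre rows-split →
      adjacent-inherits (rows-unique P) pre rows-split
        (ConsecAdj-split pre (subst ConsecAdj rows-split cubic)))

incomparable-separable-impossible : ∀ {n} (P : PrefMatrix n) → Cubic P →
  ∀ {A B a b} → a ∈ₛ A → a ∉ₛ B → b ∈ₛ B → b ∉ₛ A → A ∈char P → B ∈char P → ⊥
incomparable-separable-impossible {n} P cubic {A} {B} {a} {b} a∈A a∉B b∈B b∉A A-sep B-sep
  with rows-nonempty P
... | r₀ , rest , rows≡
  with AllPairs-total (AllPairs.zip (A.rows-inherit cubic , B.rows-inherit cubic))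
                      (∈-rows P y) (∈-rows P z) y≢z
  where
  module A = InitialSegment P A (separable⇒fibresAgree P a∈A b∉A A-sep) rows≡
  module B = InitialSegment P B (separable⇒fibresAgree P b∈B a∉B B-sep) rows≡
  y z : Outcome n
  y = r₀ [ b ]%= not
  z = r₀ [ a ]%= not
  y≢z : y ≢ z
  y≢z y≡z = restrict-flip-∈ r₀ a∈A (trans (cong (restrict A) (sym y≡z)) (restrict-flip-∉ r₀ not b∉A))
... | inj₁ (_ , y⇐z) = restrict-flip-∈ r₀ b∈B (y⇐z (restrict-flip-∉ r₀ not a∉B))
... | inj₂ (z⇐y , _) = restrict-flip-∈ r₀ a∈A (z⇐y (restrict-flip-∉ r₀ not b∉A))

theorem3 : (n : ℕ) (P : PrefMatrix n) → Cubic P →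
    (A B : Subset n) → A ∈char P → B ∈char P → (A ⊆ B) ⊎ (B ⊆ A)
theorem3 n P cubic A B A-sep B-sep with ⊆-or-∃∉ A B | ⊆-or-∃∉ B A
... | inj₁ A⊆B | _        = inj₁ A⊆B
... | inj₂ _   | inj₁ B⊆A = inj₂ B⊆A
... | inj₂ (a , a∈A , a∉B) | inj₂ (b , b∈B , b∉A) =
  ⊥-elim (incomparable-separable-impossible P cubic a∈A a∉B b∈B b∉A A-sep B-sep)
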